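{- Let $p$ be a prime and $A\in\mathrm{GL}_2(\mathbb Z_p)$ with characteristic polynomial $\chi_A$. Then $p^{2\mu(A)}$ divides the discriminant of $\chi_A$ (when $\mu(A)=\infty$ this means the discriminant is $0$).
   Context: For $A\in\mathrm{GL}_2(\mathbb Z_p)$, $\mu(A)$ denotes the largest $\mu\in\mathbb Z_{\ge 0}\cup\{\infty\}$ such that $A$ is congruent to a scalar matrix modulo $p^{\mu}$ (so $\mu(A)=\infty$ iff $A$ is scalar). -}

module Defs where

open import Data.Nat using (ℕ; suc)
open import Data.Integer as ℤ using (ℤ; +_; _-_; _*_; _+_; _^_)
open import Data.Integer.Divisibility using (_∣_)
open import Data.Product using (Σ; _×_)
open import Relation.Nullary using (¬_)

-- p-adic integers ℤ_p, modelled as coherent sequences of integers: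
-- x n is the approximation modulo p^n, and p^n ∣ x (n+1) - x n.
Seq : Set
Seq = ℕ → ℤ

record ℤₚ (p : ℕ) : Set where
  constructor mkℤₚ
  field
    seq : Seq
    coh : ∀ n → ((+ p) ^ n) ∣ (seq (suc n) - seq n)
open ℤₚ public

_⊕_ : Seq → Seq → Seq
(x ⊕ y) n = x n + y n

_⊖_ : Seq → Seq → Seq
(x ⊖ y) n = x n - y n

_⊗_ : Seq → Seq → Seq
(x ⊗ y) n = x n * y n

const : ℤ → Seq
const z n = z

infixl 6 _⊕_ _⊖_
infixl 7 _⊗_

_≈[_]_ : Seq → ℕ → Seq → Set
x ≈[ p ] y = ∀ n → ((+ p) ^ n) ∣ (x n - y n)

Divides : (p : ℕ) → Seq → Seq → Set
Divides p x y = Σ (ℤₚ p) λ c → (x ⊗ seq c) ≈[ p ] y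

IsUnit : (p : ℕ) → Seq → Set
IsUnit p x = Σ (ℤₚ p) λ v → (x ⊗ seq v) ≈[ p ] const (+ 1)

record Mat2 (p : ℕ) : Set where
  constructor mat
  field
    a b c d : ℤₚ p
open Mat2 public

det : ∀ {p} → Mat2 p → Seq
det A = seq (a A) ⊗ seq (d A) ⊖ seq (b A) ⊗ seq (c A)

tr : ∀ {p} → Mat2 p → Seq
tr A = seq (a A) ⊕ seq (d A)

InGL2 : ∀ {p} → Mat2 p → Set
InGL2 {p} A = IsUnit p (det A)

-- characteristic polynomial χ_A(X) = X² - tr(A) X + det(A);
-- its discriminant is tr(A)² - 4 det(A)
discχ : ∀ {p} → Mat2 p → Seq
discχ A = tr A ⊗ tr A ⊖ const (+ 4) ⊗ det A

CongScalarMod : ∀ {p} → Mat2 p → ℕ → Set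
CongScalarMod {p} A μ =
  Σ (ℤₚ p) λ l →
    Divides p (const ((+ p) ^ μ)) (seq (a A) ⊖ seq l) ×
    Divides p (const ((+ p) ^ μ)) (seq (b A)) ×
    Divides p (const ((+ p) ^ μ)) (seq (c A)) ×
    Divides p (const ((+ p) ^ μ)) (seq (d A) ⊖ seq l)

IsScalar : ∀ {p} → Mat2 p → Set
IsScalar {p} A =
  (seq (b A) ≈[ p ] const (+ 0)) ×
  (seq (c A) ≈[ p ] const (+ 0)) ×
  (seq (a A) ≈[ p ] seq (d A))

MuIs : ∀ {p} → Mat2 p → ℕ → Set
MuIs A μ = CongScalarMod A μ × ¬ CongScalarMod A (suc μ)

-- If A ≡ λI (mod p^μ), write A = λI + p^μ A'. The discriminant tr² − 4 det of a
-- 2×2 matrix equals (a − d)² + 4bc, so it is unchanged by adding a scalar matrix and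
-- is homogeneous of degree 2; hence disc χ_A = p^{2μ} · disc χ_{A'}.
module Submission where

open import Defs
open import Data.Nat using (ℕ; suc; _*_)
open import Data.Nat.Primality using (Prime)
open import Data.Integer using (+_; _^_)
open import Data.Product using (_×_)

import Data.Nat.Properties as ℕ
open import Data.Integer as ℤ using (ℤ; _-_; _+_)
import Data.Integer.Properties as ℤ
import Data.Integer.Divisibility as U
open import Data.Integer.Divisibility.Signed
  using (_∣_; ∣ᵤ⇒∣; ∣⇒∣ᵤ; divides; ∣m∣n⇒∣m+n; ∣m∣n⇒∣m-n; ∣m⇒∣-m; ∣n⇒∣m*n; ∣m⇒∣m*n)
open import Data.Integer.Tactic.RingSolver using (solve-∀)
open import Data.Product using (_,_)
open import Function using (_∘_)
open import Level using (0ℓ)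
open import Relation.Binary.Bundles using (Setoid)
open import Relation.Binary.Structures using (IsEquivalence)
open import Relation.Binary.PropositionalEquality as ≡ using (_≡_; subst; cong)
import Relation.Binary.Reasoning.Setoid as SetoidReasoning

infix 4 _≡_mod_

record _≡_mod_ (x y k : ℤ) : Set where
  constructor mod-intro
  field mod-elim : k ∣ x - y
open _≡_mod_

module _ {k : ℤ} where

  ≡-mod-refl : ∀ x → x ≡ x mod k
  ≡-mod-refl x = mod-intro (subst (k ∣_) (≡.sym (ℤ.+-inverseʳ x)) (divides (+ 0) ≡.refl))

  ≡-mod-sym : ∀ {x y} → x ≡ y mod k → y ≡ x mod k
  ≡-mod-sym {x} {y} (mod-intro k∣x-y) = mod-intro (subst (k ∣_) (negate-minus x y) (∣m⇒∣-m k∣x-y))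
    where
    negate-minus : ∀ x y → ℤ.- (x - y) ≡ y - x
    negate-minus = solve-∀

  ≡-mod-trans : ∀ {x y z} → x ≡ y mod k → y ≡ z mod k → x ≡ z mod k
  ≡-mod-trans {x} {y} {z} (mod-intro k∣x-y) (mod-intro k∣y-z) =
    mod-intro (subst (k ∣_) (telescope x y z) (∣m∣n⇒∣m+n k∣x-y k∣y-z))
    where
    telescope : ∀ x y z → (x - y) + (y - z) ≡ x - z
    telescope = solve-∀

  ∣ᵤ⇒≡-mod : ∀ x y → k U.∣ x - y → x ≡ y mod k
  ∣ᵤ⇒≡-mod _ _ = mod-intro ∘ ∣ᵤ⇒∣

  ≡-mod⇒∣ᵤ : ∀ {x y} → x ≡ y mod k → k U.∣ x - y
  ≡-mod⇒∣ᵤ = ∣⇒∣ᵤ ∘ mod-elim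

  ≡-mod-isEquivalence : IsEquivalence (λ x y → x ≡ y mod k)
  ≡-mod-isEquivalence = record
    { refl = ≡-mod-refl _ ; sym = ≡-mod-sym ; trans = ≡-mod-trans }

  +-cong-mod : ∀ {x x′ y y′} → x ≡ x′ mod k → y ≡ y′ mod k → x + y ≡ x′ + y′ mod k
  +-cong-mod {x} {x′} {y} {y′} (mod-intro hx) (mod-intro hy) =
    mod-intro (subst (k ∣_) (regroup x x′ y y′) (∣m∣n⇒∣m+n hx hy))
    where
    regroup : ∀ x x′ y y′ → (x - x′) + (y - y′) ≡ (x + y) - (x′ + y′)
    regroup = solve-∀

  -‿cong-mod : ∀ {x x′ y y′} → x ≡ x′ mod k → y ≡ y′ mod k → x - y ≡ x′ - y′ mod k
  -‿cong-mod {x} {x′} {y} {y′} (mod-intro hx) (mod-intro hy) =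
    mod-intro (subst (k ∣_) (regroup x x′ y y′) (∣m∣n⇒∣m-n hx hy))
    where
    regroup : ∀ x x′ y y′ → (x - x′) - (y - y′) ≡ (x - y) - (x′ - y′)
    regroup = solve-∀

  *-cong-mod : ∀ {x x′ y y′} → x ≡ x′ mod k → y ≡ y′ mod k → x ℤ.* y ≡ x′ ℤ.* y′ mod k
  *-cong-mod {x} {x′} {y} {y′} (mod-intro hx) (mod-intro hy) =
    mod-intro (subst (k ∣_) (product-difference x x′ y y′) (∣m∣n⇒∣m+n (∣n⇒∣m*n x hy) (∣m⇒∣m*n y′ hx)))
    where
    product-difference : ∀ x x′ y y′ → x ℤ.* (y - y′) + (x - x′) ℤ.* y′ ≡ x ℤ.* y - x′ ℤ.* y′
    product-difference = solve-∀

  ≡-mod-sub⇒+ : ∀ x y {z} → z ≡ x - y mod k → y + z ≡ x mod k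
  ≡-mod-sub⇒+ x y {z} (mod-intro h) = mod-intro (subst (k ∣_) (regroup x y z) h)
    where
    regroup : ∀ x y z → z - (x - y) ≡ (y + z) - x
    regroup = solve-∀

≡-mod-setoid : ℤ → Setoid 0ℓ 0ℓ
≡-mod-setoid k = record { isEquivalence = ≡-mod-isEquivalence {k} }

-- Agrees definitionally with discχ (mat A B C D) n at the entries seq A n, …, seq D n.
disc : ℤ → ℤ → ℤ → ℤ → ℤ
disc a b c d = (a + d) ℤ.* (a + d) - + 4 ℤ.* (a ℤ.* d - b ℤ.* c)

disc-cong-mod : ∀ {k a a′ b b′ c c′ d d′} →
  a ≡ a′ mod k → b ≡ b′ mod k → c ≡ c′ mod k → d ≡ d′ mod k →
  disc a b c d ≡ disc a′ b′ c′ d′ mod k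
disc-cong-mod ha hb hc hd =
  -‿cong-mod (*-cong-mod (+-cong-mod ha hd) (+-cong-mod ha hd))
             (*-cong-mod (≡-mod-refl (+ 4)) (-‿cong-mod (*-cong-mod ha hd) (*-cong-mod hb hc)))

disc-scalar+scaled : ∀ l q a b c d →
  disc (l + q ℤ.* a) (q ℤ.* b) (q ℤ.* c) (l + q ℤ.* d) ≡ q ℤ.* q ℤ.* disc a b c d
disc-scalar+scaled = polynomial-identity
  where
  -- solve-∀ does not unfold disc, so the identity is stated with disc expanded.
  polynomial-identity : ∀ l q a b c d →
    ((l + q ℤ.* a) + (l + q ℤ.* d)) ℤ.* ((l + q ℤ.* a) + (l + q ℤ.* d))
      - + 4 ℤ.* ((l + q ℤ.* a) ℤ.* (l + q ℤ.* d) - (q ℤ.* b) ℤ.* (q ℤ.* c))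
    ≡ q ℤ.* q ℤ.* ((a + d) ℤ.* (a + d) - + 4 ℤ.* (a ℤ.* d - b ℤ.* c))
  polynomial-identity = solve-∀

disc-scalar : ∀ a → disc a (+ 0) (+ 0) a ≡ + 0
disc-scalar = polynomial-identity
  where
  polynomial-identity : ∀ a → (a + a) ℤ.* (a + a) - + 4 ℤ.* (a ℤ.* a - + 0 ℤ.* + 0) ≡ + 0
  polynomial-identity = solve-∀

disc-congScalar-mod : ∀ {k} q l {a b c d a′ b′ c′ d′} →
  q ℤ.* a′ ≡ a - l mod k → q ℤ.* b′ ≡ b mod k → q ℤ.* c′ ≡ c mod k → q ℤ.* d′ ≡ d - l mod k →
  q ℤ.* q ℤ.* disc a′ b′ c′ d′ ≡ disc a b c d mod k
disc-congScalar-mod {k} q l {a} {b} {c} {d} {a′} {b′} {c′} {d′} ha hb hc hd = begin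
  q ℤ.* q ℤ.* disc a′ b′ c′ d′                             ≡⟨ ≡.sym (disc-scalar+scaled l q a′ b′ c′ d′) ⟩
  disc (l + q ℤ.* a′) (q ℤ.* b′) (q ℤ.* c′) (l + q ℤ.* d′)
    ≈⟨ disc-cong-mod (≡-mod-sub⇒+ a l ha) hb hc (≡-mod-sub⇒+ d l hd) ⟩
  disc a b c d                                             ∎
  where open SetoidReasoning (≡-mod-setoid k)

module _ {p : ℕ} where

  coherent : (X : ℤₚ p) → ∀ n → seq X (suc n) ≡ seq X n mod (+ p) ^ n
  coherent X n = ∣ᵤ⇒≡-mod _ _ (coh X n)

  discₚ : Mat2 p → ℤₚ p
  discₚ (mat A B C D) = mkℤₚ (discχ (mat A B C D)) λ n →
    ≡-mod⇒∣ᵤ (disc-cong-mod (coherent A n) (coherent B n) (coherent C n) (coherent D n))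

  discχ-congScalarMod : (A : Mat2 p) (μ : ℕ) → CongScalarMod A μ →
    Divides p (const ((+ p) ^ (2 * μ))) (discχ A)
  discχ-congScalarMod (mat A B C D) μ (L , (A′ , hA) , (B′ , hB) , (C′ , hC) , (D′ , hD)) =
    discₚ (mat A′ B′ C′ D′) , λ n →
      subst (λ e → (+ p) ^ n U.∣ e ℤ.* discχ (mat A′ B′ C′ D′) n - discχ (mat A B C D) n)
            (≡.sym (^-double (+ p) μ))
            (≡-mod⇒∣ᵤ (congruence n))
    where
    q = (+ p) ^ μ

    ^-double : ∀ x m → x ^ (2 * m) ≡ x ^ m ℤ.* x ^ m
    ^-double x m = ≡.trans (ℤ.^-distribˡ-+-* x m _) (cong (λ e → x ^ m ℤ.* x ^ e) (ℕ.+-identityʳ m))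

    congruence : ∀ n → q ℤ.* q ℤ.* discχ (mat A′ B′ C′ D′) n ≡ discχ (mat A B C D) n mod (+ p) ^ n
    congruence n = disc-congScalar-mod q lₙ {aₙ} {bₙ} {cₙ} {dₙ} {a′ₙ} {b′ₙ} {c′ₙ} {d′ₙ}
      (∣ᵤ⇒≡-mod _ _ (hA n)) (∣ᵤ⇒≡-mod _ _ (hB n)) (∣ᵤ⇒≡-mod _ _ (hC n)) (∣ᵤ⇒≡-mod _ _ (hD n))
      where
      aₙ = seq A n ; bₙ = seq B n ; cₙ = seq C n ; dₙ = seq D n ; lₙ = seq L n
      a′ₙ = seq A′ n ; b′ₙ = seq B′ n ; c′ₙ = seq C′ n ; d′ₙ = seq D′ n

  discχ-scalar : (A : Mat2 p) → IsScalar A → discχ A ≈[ p ] const (+ 0)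
  discχ-scalar (mat A B C D) (b≈0 , c≈0 , a≈d) n = ≡-mod⇒∣ᵤ (begin
    disc aₙ bₙ cₙ dₙ         ≈⟨ disc-cong-mod (∣ᵤ⇒≡-mod aₙ dₙ (a≈d n)) (∣ᵤ⇒≡-mod bₙ (+ 0) (b≈0 n))
                                               (∣ᵤ⇒≡-mod cₙ (+ 0) (c≈0 n)) (≡-mod-refl dₙ) ⟩
    disc dₙ (+ 0) (+ 0) dₙ   ≡⟨ disc-scalar dₙ ⟩
    + 0                      ∎)
    where
    open SetoidReasoning (≡-mod-setoid ((+ p) ^ n))
    aₙ = seq A n ; bₙ = seq B n ; cₙ = seq C n ; dₙ = seq D n

lemma4p2 : (p : ℕ) → Prime p → (A : Mat2 p) → InGL2 A →
    ((μ : ℕ) → MuIs A μ → Divides p (const ((+ p) ^ (2 * μ))) (discχ A)) ×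
    (IsScalar A → discχ A ≈[ p ] const (+ 0))
lemma4p2 p _ A _ = (λ μ (congScalar , _) → discχ-congScalarMod A μ congScalar) , discχ-scalar A
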